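{- There is a constant $C>0$ such that for every $n\in\mathbb{N}$ with $n\ge 1$ there exists a DNNF circuit of size at most $2^{Cn}$ expressing $\mathrm{lin}_n$ (i.e., $\mathrm{lin}_n$ has DNNF circuits of size $2^{O(n)}$).
   Context: $[n]=\{1,\dots,n\}$. $\mathrm{lin}_n$ is the Boolean function over the variables $\{x_{i,j}: i,j\in[n],\ i<j\}$ whose satisfying assignments $\alpha$ are exactly those for which there is a linear order $\prec$ on $[n]$ with $\alpha(x_{i,j})=1\iff i\prec j$ for all $i<j$. A Boolean circuit in NNF is a rooted DAG with leaves labelled $\top$, $\bot$, $x$ or $\neg x$ for variables $x$, and internal nodes labelled $\wedge$ or $\vee$; it is a DNNF circuit if for every $\wedge$-node any two children root subcircuits with disjoint variable sets. A circuit expresses a function if it computes it on every assignment. Size is the number of nodes and edges. -}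

module Defs where

open import Level using (0ℓ)
open import Data.Nat using (ℕ; zero; suc; _+_; _<_)
open import Data.Fin using (Fin; toℕ)
open import Data.Bool using (Bool; true; false; _∧_; _∨_; not)
open import Data.List using (List; []; _∷_; foldr; map; concatMap; length)
open import Data.List.Membership.Propositional using (_∈_)
open import Data.Vec using (Vec; lookup; _∷ʳ_)
import Data.Vec as Vec
open import Data.Product using (_×_; Σ; ∃)
open import Data.Empty using (⊥)
open import Relation.Binary.PropositionalEquality using (_≡_; _≢_)
open import Relation.Binary.Structures using (IsStrictTotalOrder)
open import Function.Bundles using (_⇔_)

record Var (n : ℕ) : Set where
  constructor x
  field
    i   : Fin n
    j   : Fin n
    i<j : toℕ i < toℕ j

lin : (n : ℕ) → (Var n → Bool) → Set₁
lin n α = Σ (Fin n → Fin n → Set) λ _≺_ →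
  IsStrictTotalOrder _≡_ _≺_ ×
  ((v : Var n) → (α v ≡ true) ⇔ (Var.i v ≺ Var.j v))

-- NNF circuits as DAGs, nodes listed in topological order:
-- a gate added when m nodes exist may only point to nodes in Fin m.

data Gate (V : Set) (m : ℕ) : Set where
  top bot : Gate V m
  pos neg : V → Gate V m
  andG orG : List (Fin m) → Gate V m

data Circ (V : Set) : ℕ → Set where
  []  : Circ V 0
  _▷_ : {m : ℕ} → Circ V m → Gate V m → Circ V (suc m)

andL orL : List Bool → Bool
andL = foldr _∧_ true
orL  = foldr _∨_ false

evalGate : {V : Set} {m : ℕ} → (V → Bool) → Vec Bool m → Gate V m → Bool
evalGate α vs top = true
evalGate α vs bot = false
evalGate α vs (pos v) = α v
evalGate α vs (neg v) = not (α v)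
evalGate α vs (andG cs) = andL (map (lookup vs) cs)
evalGate α vs (orG cs) = orL (map (lookup vs) cs)

values : {V : Set} {m : ℕ} → Circ V m → (V → Bool) → Vec Bool m
values [] α = Vec.[]
values (C ▷ g) α = values C α ∷ʳ evalGate α (values C α) g

varsGate : {V : Set} {m : ℕ} → Vec (List V) m → Gate V m → List V
varsGate vs top = []
varsGate vs bot = []
varsGate vs (pos v) = v ∷ []
varsGate vs (neg v) = v ∷ []
varsGate vs (andG cs) = concatMap (lookup vs) cs
varsGate vs (orG cs) = concatMap (lookup vs) cs

vars : {V : Set} {m : ℕ} → Circ V m → Vec (List V) m
vars [] = Vec.[]
vars (C ▷ g) = vars C ∷ʳ varsGate (vars C) g

Disjoint : {V : Set} → List V → List V → Set
Disjoint xs ys = ∀ v → v ∈ xs → v ∈ ys → ⊥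

DecGate : {V : Set} {m : ℕ} → Vec (List V) m → Gate V m → Set
DecGate vs (andG cs) = ∀ c d → c ∈ cs → d ∈ cs → c ≢ d →
                       Disjoint (lookup vs c) (lookup vs d)
DecGate vs _ = Data.Unit.⊤
  where import Data.Unit

IsDNNF : {V : Set} {m : ℕ} → Circ V m → Set
IsDNNF [] = Data.Unit.⊤
  where import Data.Unit
IsDNNF (C ▷ g) = IsDNNF C × DecGate (vars C) g

edges : {V : Set} {m : ℕ} → Circ V m → ℕ
edges [] = 0
edges (C ▷ andG cs) = edges C + length cs
edges (C ▷ orG cs) = edges C + length cs
edges (C ▷ _) = edges C

record RCirc (V : Set) : Set where
  constructor rcirc
  field
    nodes : ℕ
    circ  : Circ V nodes
    root  : Fin nodes

size : {V : Set} → RCirc V → ℕ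
size (rcirc m C r) = m + edges C

eval : {V : Set} → RCirc V → (V → Bool) → Bool
eval (rcirc m C r) α = lookup (values C α) r

Expresses : {V : Set} → RCirc V → ((V → Bool) → Set₁) → Set₁
Expresses D f = ∀ α → Lift (Level.suc 0ℓ) (eval D α ≡ true) ⇔ f α
  where open import Level using (Lift)
        import Level

-- A node of the circuit is kept for every subset S ⊆ [n] and every k ≤ n; it
-- computes whether, provided |S| = k, the restriction of α to the pairs inside S
-- is induced by a linear order on S. Such an order exists iff some i ∈ S can be
-- put first: every literal "i ≺ j" with j ∈ S holds and the order on S − i
-- exists. This gives an ∨ over i of ∧-nodes whose children are the literals, the
-- test i ∈ S and the node for S − i; they are decomposable because the literals
-- mention i while the subcircuit for S − i does not. There are n·2ⁿ such
-- ∨-nodes, each with O(n) nodes of fan-in O(n) below it, hence size 2^O(n).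

module Submission where

open import Defs
open import Data.Bool using (Bool; true; false; _∧_; not; T)
open import Data.Bool.ListAction using (and; or; all; any)
open import Data.Bool.Properties using (T-∧; T-≡)
open import Data.Empty using (⊥; ⊥-elim)
open import Data.Fin using (Fin; zero; suc; toℕ; inject₁; fromℕ; _≟_)
open import Data.Fin.Subset using (Subset; inside; outside; _-_; ∣_∣; ⊤; Nonempty) renaming (_∈_ to _∈ₛ_)
open import Data.Fin.Subset.Properties
  using (_∈?_; ∈⊤; ∣⊤∣≡n; ∣⊥∣≡0; p─⊥≡p; p─q⊆p; x∈p∧x≢y⇒x∈p-y; nonempty?; Empty-unique)
import Data.List.Extrema
open import Data.List using (List; []; _∷_; map; allFin; length; concatMap; filter)
open import Data.List.Membership.Propositional using (_∈_; find; lose)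
open import Data.List.Membership.Propositional.Properties using (∈-allFin; ∈-filter⁺; ∈-concatMap⁻; ∈-map⁻)
open import Data.List.Properties using (map-∘; map-cong; length-map; length-tabulate)
open import Data.List.Relation.Unary.All as All using (All)
open import Data.List.Relation.Unary.All.Properties using (all-filter; all⁺; all⁻)
open import Data.List.Relation.Unary.Any using (here; there; satisfied)
open import Data.List.Relation.Unary.Any.Properties using (any⁺; any⁻)
open import Data.Nat using (ℕ; zero; suc; _+_; _*_; _^_; _≤_; _<_; z≤n; s≤s; s<s⁻¹)
open import Data.Nat.Properties
  using ( +-assoc; +-comm; +-identityʳ; *-assoc; *-comm; *-suc; *-identityʳ; *-distribʳ-+
        ; ≤-refl; ≤-trans; ≤-reflexive; <⇒≤; +-mono-≤; +-monoʳ-≤; *-mono-≤; *-monoˡ-≤; *-monoʳ-≤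
        ; n≤1+n; m≤m+n; m≤n+m; <-cmp; <-irrefl; <-asym; <-trans; <-irrelevant; suc-injective; 0≢1+n
        ; m^n>0; ^-monoʳ-≤; ^-distribˡ-+-*; ^-*-assoc; module ≤-Reasoning)
open import Data.Product using (Σ; _×_; _,_; proj₁; proj₂)
open import Data.Sum using (_⊎_; inj₁; inj₂; [_,_]′)
open import Data.Unit as Unit using (tt)
open import Data.Vec using (Vec; []; _∷_; lookup; _∷ʳ_)
open import Function.Bundles using (_⇔_; mk⇔; Equivalence)
open import Level using (0ℓ; lift; lower)
open import Relation.Binary.Bundles using (TotalOrder)
import Relation.Binary.Construct.StrictToNonStrict as StrictToNonStrict
open import Relation.Binary.Definitions using (Trichotomous; tri<; tri≈; tri>)
open import Relation.Binary.PropositionalEquality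
  using (_≡_; _≢_; refl; sym; trans; cong; cong₂; subst; isEquivalence)
open import Relation.Binary.Structures using (IsStrictTotalOrder)
open import Relation.Nullary using (Dec; yes; no; ¬_)
open import Relation.Nullary.Decidable using (isYes; _×-dec_; fromWitness; toWitness)

lookup-∷ʳ-inject₁ : ∀ {A : Set} {m} (xs : Vec A m) y (k : Fin m) → lookup (xs ∷ʳ y) (inject₁ k) ≡ lookup xs k
lookup-∷ʳ-inject₁ (_ ∷ _)  y zero    = refl
lookup-∷ʳ-inject₁ (_ ∷ xs) y (suc k) = lookup-∷ʳ-inject₁ xs y k

lookup-∷ʳ-fromℕ : ∀ {A : Set} {m} (xs : Vec A m) y → lookup (xs ∷ʳ y) (fromℕ m) ≡ y
lookup-∷ʳ-fromℕ []       y = refl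
lookup-∷ʳ-fromℕ (_ ∷ xs) y = lookup-∷ʳ-fromℕ xs y

guarded : {P : Set} → Dec P → Bool → Bool
guarded (yes _) b = b
guarded (no _)  _ = true

T-guarded⁻ : ∀ {P : Set} (d : Dec P) {b} → T (guarded d b) → P → T b
T-guarded⁻ (yes _) t _ = t
T-guarded⁻ (no ¬p) _ p = ⊥-elim (¬p p)

T-guarded⁺ : ∀ {P : Set} (d : Dec P) {b} → (P → T b) → T (guarded d b)
T-guarded⁺ (yes p) f = f p
T-guarded⁺ (no _)  _ = tt

module _ {V : Set} where

  infix 4 _⊑_

  data _⊑_ {m} (C : Circ V m) : ∀ {m′} → Circ V m′ → Set where
    ⊑-refl : C ⊑ C
    ⊑-▷    : ∀ {m′} {C′ : Circ V m′} {g} → C ⊑ C′ → C ⊑ C′ ▷ g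

  ⊑-trans : ∀ {m₁ m₂ m₃} {C₁ : Circ V m₁} {C₂ : Circ V m₂} {C₃ : Circ V m₃} →
            C₁ ⊑ C₂ → C₂ ⊑ C₃ → C₁ ⊑ C₃
  ⊑-trans e ⊑-refl    = e
  ⊑-trans e (⊑-▷ e′) = ⊑-▷ (⊑-trans e e′)

  weaken : ∀ {m m′} {C : Circ V m} {C′ : Circ V m′} → C ⊑ C′ → Fin m → Fin m′
  weaken ⊑-refl  k = k
  weaken (⊑-▷ e) k = inject₁ (weaken e k)

  values-weaken : ∀ {m m′} {C : Circ V m} {C′ : Circ V m′} (e : C ⊑ C′) α k →
                  lookup (values C′ α) (weaken e k) ≡ lookup (values C α) k
  values-weaken ⊑-refl                 α k = refl
  values-weaken (⊑-▷ {C′ = C′} e) α k =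
    trans (lookup-∷ʳ-inject₁ (values C′ α) _ (weaken e k)) (values-weaken e α k)

  vars-weaken : ∀ {m m′} {C : Circ V m} {C′ : Circ V m′} (e : C ⊑ C′) k →
                lookup (vars C′) (weaken e k) ≡ lookup (vars C) k
  vars-weaken ⊑-refl                 k = refl
  vars-weaken (⊑-▷ {C′ = C′} e) k =
    trans (lookup-∷ʳ-inject₁ (vars C′) _ (weaken e k)) (vars-weaken e k)

  record Computes {m} (C : Circ V m) (k : Fin m) (f : (V → Bool) → Bool) (P : V → Set) : Set where
    field
      value   : ∀ α → lookup (values C α) k ≡ f α
      support : ∀ {v} → v ∈ lookup (vars C) k → P v

  open Computes public

  Computes-weaken : ∀ {m m′} {C : Circ V m} {C′ : Circ V m′} {k f P} (e : C ⊑ C′) →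
                    Computes C k f P → Computes C′ (weaken e k) f P
  Computes-weaken {k = k} e c = record
    { value   = λ α → trans (values-weaken e α k) (value c α)
    ; support = λ v∈ → support c (subst (_ ∈_) (vars-weaken e k) v∈)
    }

  fanIn : ∀ {m} → Gate V m → ℕ
  fanIn (andG cs) = length cs
  fanIn (orG cs)  = length cs
  fanIn _         = 0

  edges-▷ : ∀ {m} (C : Circ V m) (g : Gate V m) → edges (C ▷ g) ≡ edges C + fanIn g
  edges-▷ C top      = sym (+-identityʳ _)
  edges-▷ C bot      = sym (+-identityʳ _)
  edges-▷ C (pos _)  = sym (+-identityʳ _)
  edges-▷ C (neg _)  = sym (+-identityʳ _)
  edges-▷ C (andG _) = refl
  edges-▷ C (orG _)  = refl

  DecGate-byOwner : ∀ {m} (vs : Vec (List V) m) (cs : List (Fin m)) (owner : V → Fin m) →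
                    (∀ {c v} → c ∈ cs → v ∈ lookup vs c → c ≡ owner v) → DecGate vs (andG cs)
  DecGate-byOwner vs cs owner owns c d c∈ d∈ c≢d v v∈c v∈d = c≢d (trans (owns c∈ v∈c) (sym (owns d∈ v∈d)))

  varsGate-children : ∀ {m} {P : V → Set} (vs : Vec (List V) m) (cs : List (Fin m)) →
                      (∀ {c v} → c ∈ cs → v ∈ lookup vs c → P v) → ∀ {v} → v ∈ concatMap (lookup vs) cs → P v
  varsGate-children vs cs children-P v∈ with find (∈-concatMap⁻ (lookup vs) {cs} v∈)
  ... | c , c∈ , v∈c = children-P c∈ v∈c

  map-children : ∀ {m} {I : Set} {P : V → Set} (vs : Vec (List V) m) (node : I → Fin m) (xs : List I) →
                 (∀ i {v} → v ∈ lookup vs (node i) → P v) → ∀ {c v} → c ∈ map node xs → v ∈ lookup vs c → P v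
  map-children vs node xs node-P c∈ v∈ with ∈-map⁻ node c∈
  ... | i , _ , refl = node-P i v∈

  guardedGate : ∀ {m} {P : Set} → Dec P → Gate V m → Gate V m
  guardedGate (yes _) g = g
  guardedGate (no _)  _ = top

  indicatorGate : ∀ {m} {P : Set} → Dec P → Gate V m
  indicatorGate (yes _) = top
  indicatorGate (no _)  = bot

  guardedGate-eval : ∀ {m} {P : Set} α (vs : Vec Bool m) (d : Dec P) g →
                     evalGate α vs (guardedGate d g) ≡ guarded d (evalGate α vs g)
  guardedGate-eval α vs (yes _) g = refl
  guardedGate-eval α vs (no _)  g = refl

  guardedGate-vars : ∀ {m} {P : Set} (vs : Vec (List V) m) (d : Dec P) g {v} →
                     v ∈ varsGate vs (guardedGate d g) → P × v ∈ varsGate vs g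
  guardedGate-vars vs (yes p) g v∈ = p , v∈

  guardedGate-dec : ∀ {m} {P : Set} (vs : Vec (List V) m) (d : Dec P) g → DecGate vs g → DecGate vs (guardedGate d g)
  guardedGate-dec vs (yes _) g dg = dg
  guardedGate-dec vs (no _)  g dg = tt

  guardedGate-fanIn : ∀ {m} {P : Set} (d : Dec P) (g : Gate V m) → fanIn (guardedGate d g) ≤ fanIn g
  guardedGate-fanIn (yes _) g = ≤-refl
  guardedGate-fanIn (no _)  g = z≤n

  indicatorGate-eval : ∀ {m} {P : Set} α (vs : Vec Bool m) (d : Dec P) → evalGate α vs (indicatorGate d) ≡ isYes d
  indicatorGate-eval α vs (yes _) = refl
  indicatorGate-eval α vs (no _)  = refl

  indicatorGate-vars : ∀ {m} {P : Set} (vs : Vec (List V) m) (d : Dec P) {v} → v ∈ varsGate vs (indicatorGate d) → ⊥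
  indicatorGate-vars vs (yes _) ()
  indicatorGate-vars vs (no _)  ()

  indicatorGate-dec : ∀ {m} {P : Set} (vs : Vec (List V) m) (d : Dec P) → DecGate vs (indicatorGate d)
  indicatorGate-dec vs (yes _) = tt
  indicatorGate-dec vs (no _)  = tt

  indicatorGate-fanIn : ∀ {m} {P : Set} (d : Dec P) → fanIn {m = m} (indicatorGate d) ≡ 0
  indicatorGate-fanIn (yes _) = refl
  indicatorGate-fanIn (no _)  = refl

module Building {V : Set} (K : ℕ) where

  record Builder : Set where
    constructor builder
    field
      nodes  : ℕ
      circ   : Circ V nodes
      dnnf   : IsDNNF circ
      edges≤ : edges circ ≤ K * nodes

  open Builder public

  empty : Builder
  empty = builder 0 [] tt z≤n

  push : (b : Builder) (g : Gate V (nodes b)) → DecGate (vars (circ b)) g → fanIn g ≤ K → Builder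
  push (builder m C dn e≤) g dg g≤ = builder (suc m) (C ▷ g) (dn , dg) (begin
    edges (C ▷ g)    ≡⟨ edges-▷ C g ⟩
    edges C + fanIn g ≤⟨ +-mono-≤ e≤ g≤ ⟩
    K * m + K        ≡⟨ +-comm (K * m) K ⟩
    K + K * m        ≡⟨ sym (*-suc K m) ⟩
    K * suc m        ∎)
    where open ≤-Reasoning

  record Growth (b : Builder) (d : ℕ) (I : Set) (f : I → (V → Bool) → Bool) (P : I → V → Set) : Set where
    constructor growth
    field
      result   : Builder
      extends  : circ b ⊑ circ result
      grows    : nodes result ≡ d + nodes b
      node     : I → Fin (nodes result)
      computes : ∀ i → Computes (circ result) (node i) (f i) (P i)

  open Growth public

  Table : ∀ {m₀} → Circ V m₀ → ℕ → (I : Set) → (I → (V → Bool) → Bool) → (I → V → Set) → Set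
  Table C₀ d I f P = ∀ b → C₀ ⊑ circ b → Growth b d I f P

  Step : ∀ {m₀} → Circ V m₀ → ℕ → ((V → Bool) → Bool) → (V → Set) → Set
  Step C₀ d f P = Table C₀ d Unit.⊤ (λ _ → f) (λ _ → P)

  pushGate : ∀ {f P} (b : Builder) (g : Gate V (nodes b)) → DecGate (vars (circ b)) g → fanIn g ≤ K →
             (∀ α → evalGate α (values (circ b) α) g ≡ f α) →
             (∀ {v} → v ∈ varsGate (vars (circ b)) g → P v) →
             Growth b 1 Unit.⊤ (λ _ → f) (λ _ → P)
  pushGate b g dg g≤ val sup = growth (push b g dg g≤) (⊑-▷ ⊑-refl) refl (λ _ → fromℕ (nodes b)) λ _ → record
    { value   = λ α → trans (lookup-∷ʳ-fromℕ (values (circ b) α) _) (val α)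
    ; support = λ v∈ → sup (subst (_ ∈_) (lookup-∷ʳ-fromℕ (vars (circ b)) _) v∈)
    }

  grows-trans : ∀ {m m₁ m₂} d₁ d₂ → m₂ ≡ d₂ + m₁ → m₁ ≡ d₁ + m → m₂ ≡ (d₂ + d₁) + m
  grows-trans {m} d₁ d₂ p q = trans p (trans (cong (d₂ +_) q) (sym (+-assoc d₂ d₁ m)))

  infixr 4 _⨾_

  _⨾_ : ∀ {b d₁ d₂ I J f h P Q} (g : Growth b d₁ I f P) → Growth (result g) d₂ J h Q →
        Growth b (d₂ + d₁) J h Q
  _⨾_ {d₁ = d₁} {d₂} g g′ = growth (result g′) (⊑-trans (extends g) (extends g′))
                                   (grows-trans d₁ d₂ (grows g′) (grows g)) (node g′) (computes g′)

  forFin : ∀ {m₀} {C₀ : Circ V m₀} n {d f P} → (∀ j → Step C₀ d (f j) (P j)) → Table C₀ (n * d) (Fin n) f P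
  forFin zero    step b e = growth b ⊑-refl refl (λ ()) (λ ())
  forFin (suc n) {d} {f} {P} step b e =
    growth (result g₀) (⊑-trans (extends g) (extends g₀)) (grows-trans (n * d) d (grows g₀) (grows g)) node′ computes′
    where
      g : Growth b (n * d) (Fin n) (λ j → f (suc j)) (λ j → P (suc j))
      g = forFin n (λ j → step (suc j)) b e
      g₀ : Growth (result g) d Unit.⊤ (λ _ → f zero) (λ _ → P zero)
      g₀ = step zero (result g) (⊑-trans e (extends g))
      node′ : Fin (suc n) → Fin (nodes (result g₀))
      node′ zero    = node g₀ tt
      node′ (suc j) = weaken (extends g₀) (node g j)
      computes′ : ∀ j → Computes (circ (result g₀)) (node′ j) (f j) (P j)
      computes′ zero    = computes g₀ tt
      computes′ (suc j) = Computes-weaken (extends g₀) (computes g j)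

  forSubset : ∀ {m₀} {C₀ : Circ V m₀} n {d f P} → (∀ S → Step C₀ d (f S) (P S)) → Table C₀ (2 ^ n * d) (Subset n) f P
  forSubset zero {d} step b e =
    growth (result g) (extends g) (trans (grows g) (cong (_+ nodes b) (sym (+-identityʳ d))))
           (λ _ → node g tt) λ { [] → computes g tt }
    where g = step [] b e
  forSubset (suc n) {d} {f} {P} step b e =
    growth (result g₁) (⊑-trans (extends g₀) (extends g₁)) grows′ node′ computes′
    where
      D : ℕ
      D = 2 ^ n * d
      g₀ : Growth b D (Subset n) (λ S → f (outside ∷ S)) (λ S → P (outside ∷ S))
      g₀ = forSubset n (λ S → step (outside ∷ S)) b e
      g₁ : Growth (result g₀) D (Subset n) (λ S → f (inside ∷ S)) (λ S → P (inside ∷ S))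
      g₁ = forSubset n (λ S → step (inside ∷ S)) (result g₀) (⊑-trans e (extends g₀))
      grows′ : nodes (result g₁) ≡ 2 ^ suc n * d + nodes b
      grows′ = trans (grows-trans D D (grows g₁) (grows g₀))
                     (cong (_+ nodes b) (trans (cong (D +_) (sym (+-identityʳ D))) (sym (*-assoc 2 (2 ^ n) d))))
      node′ : Subset (suc n) → Fin (nodes (result g₁))
      node′ (outside ∷ S) = weaken (extends g₁) (node g₀ S)
      node′ (inside ∷ S)  = node g₁ S
      computes′ : ∀ S → Computes (circ (result g₁)) (node′ S) (f S) (P S)
      computes′ (outside ∷ S) = Computes-weaken (extends g₁) (computes g₀ S)
      computes′ (inside ∷ S)  = computes g₁ S

module _ where

  open import Data.Vec.Base using (here; there)

  ∣p∣≡suc∣p-x∣ : ∀ {n} {p : Subset n} {x} → x ∈ₛ p → ∣ p ∣ ≡ suc ∣ p - x ∣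
  ∣p∣≡suc∣p-x∣ {p = inside ∷ p}  here        = cong (λ q → suc ∣ q ∣) (sym (p─⊥≡p p))
  ∣p∣≡suc∣p-x∣ {p = inside ∷ p}  (there x∈p) = cong suc (∣p∣≡suc∣p-x∣ x∈p)
  ∣p∣≡suc∣p-x∣ {p = outside ∷ p} (there x∈p) = ∣p∣≡suc∣p-x∣ x∈p

  x∉p-x : ∀ {n} {p : Subset n} {x} → ¬ (x ∈ₛ p - x)
  x∉p-x {p = _ ∷ _} {suc _} (there x∈) = x∉p-x x∈

  ∣p∣≡suc⇒nonempty : ∀ {n k} {p : Subset n} → ∣ p ∣ ≡ suc k → Nonempty p
  ∣p∣≡suc⇒nonempty {n} {p = p} ∣p∣≡ with nonempty? p
  ... | yes ne = ne
  ... | no ¬ne with () ← trans (sym ∣p∣≡) (trans (cong ∣_∣ (Empty-unique ¬ne)) (∣⊥∣≡0 n))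

module _ {n} {_≺_ : Fin n → Fin n → Set} (sto : IsStrictTotalOrder _≡_ _≺_) where

  private
    totalOrder : TotalOrder 0ℓ 0ℓ 0ℓ
    totalOrder = record { isTotalOrder = StrictToNonStrict.isTotalOrder _≡_ _≺_ sto }

  open Data.List.Extrema totalOrder using (min; argmin-all; min≤xs)

  least : (S : Subset n) → Nonempty S → Σ (Fin n) λ m → m ∈ₛ S × (∀ {y} → y ∈ₛ S → m ≺ y ⊎ m ≡ y)
  least S (c , c∈S) = m , argmin-all (λ y → y) c∈S (all-filter (_∈? S) (allFin n)) , m≤
    where
      m : Fin n
      m = min c (filter (_∈? S) (allFin n))
      m≤ : ∀ {y} → y ∈ₛ S → m ≺ y ⊎ m ≡ y
      m≤ y∈S = All.lookup (min≤xs c _) (∈-filter⁺ (_∈? S) (∈-allFin _) y∈S)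

<-on-injective-isStrictTotalOrder : {A : Set} (f : A → ℕ) → (∀ {a b} → f a ≡ f b → a ≡ b) →
                                    IsStrictTotalOrder _≡_ (λ a b → f a < f b)
<-on-injective-isStrictTotalOrder f f-inj = record
  { isStrictPartialOrder = record
    { isEquivalence = isEquivalence
    ; irrefl        = λ { refl → <-irrefl refl }
    ; trans         = <-trans
    ; <-resp-≈      = (λ { refl lt → lt }) , (λ { refl lt → lt })
    }
  ; compare = compare
  }
  where
    compare : Trichotomous _≡_ (λ a b → f a < f b)
    compare a b with <-cmp (f a) (f b)
    ... | tri< lt _ _ = tri< lt (λ { refl → <-irrefl refl lt }) (<-asym lt)
    ... | tri≈ _ eq _ = tri≈ (<-irrefl eq) (f-inj eq) (<-irrefl (sym eq))
    ... | tri> _ _ gt = tri> (<-asym gt) (λ { refl → <-irrefl refl gt }) gt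

module LinCircuit (n : ℕ) where

  Within : Subset n → Var n → Set
  Within S v = Var.i v ∈ₛ S × Var.j v ∈ₛ S

  Joins : Fin n → Fin n → Var n → Set
  Joins i j v = (Var.i v ≡ i × Var.j v ≡ j) ⊎ (Var.i v ≡ j × Var.j v ≡ i)

  endpoints-distinct : (v : Var n) → Var.i v ≢ Var.j v
  endpoints-distinct v eq = <-irrefl (cong toℕ eq) (Var.i<j v)

  before : (Var n → Bool) → Fin n → Fin n → Bool
  before α i j with <-cmp (toℕ i) (toℕ j)
  ... | tri< i<j _ _ = α (x i j i<j)
  ... | tri≈ _ _ _   = true
  ... | tri> _ _ j<i = not (α (x j i j<i))

  beforeGate : ∀ {m} → Fin n → Fin n → Gate (Var n) m
  beforeGate i j with <-cmp (toℕ i) (toℕ j)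
  ... | tri< i<j _ _ = pos (x i j i<j)
  ... | tri≈ _ _ _   = top
  ... | tri> _ _ j<i = neg (x j i j<i)

  beforeGate-eval : ∀ {m} α (vs : Vec Bool m) i j → evalGate α vs (beforeGate i j) ≡ before α i j
  beforeGate-eval α vs i j with <-cmp (toℕ i) (toℕ j)
  ... | tri< _ _ _ = refl
  ... | tri≈ _ _ _ = refl
  ... | tri> _ _ _ = refl

  beforeGate-vars : ∀ {m} (vs : Vec (List (Var n)) m) i j {v} → v ∈ varsGate vs (beforeGate i j) → Joins i j v
  beforeGate-vars vs i j v∈ with <-cmp (toℕ i) (toℕ j) | v∈
  ... | tri< _ _ _ | here refl = inj₁ (refl , refl)
  ... | tri> _ _ _ | here refl = inj₂ (refl , refl)

  beforeGate-dec : ∀ {m} (vs : Vec (List (Var n)) m) i j → DecGate vs (beforeGate i j)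
  beforeGate-dec vs i j with <-cmp (toℕ i) (toℕ j)
  ... | tri< _ _ _ = tt
  ... | tri≈ _ _ _ = tt
  ... | tri> _ _ _ = tt

  beforeGate-fanIn : ∀ {m} i j → fanIn {m = m} (beforeGate i j) ≡ 0
  beforeGate-fanIn i j with <-cmp (toℕ i) (toℕ j)
  ... | tri< _ _ _ = refl
  ... | tri≈ _ _ _ = refl
  ... | tri> _ _ _ = refl

  relevant? : (S : Subset n) (i j : Fin n) → Dec (i ∈ₛ S × j ∈ₛ S)
  relevant? S i j = i ∈? S ×-dec j ∈? S

  litValue : (Var n → Bool) → Subset n → Fin n → Fin n → Bool
  litValue α S i j = guarded (relevant? S i j) (before α i j)

  precedesAll : (Var n → Bool) → Subset n → Fin n → Bool
  precedesAll α S i = all (litValue α S i) (allFin n)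

  consistent : (Var n → Bool) → ℕ → Subset n → Bool
  consistent α zero    S = true
  consistent α (suc k) S = any (λ i → isYes (i ∈? S) ∧ (consistent α k (S - i) ∧ precedesAll α S i)) (allFin n)

  startsWith : (Var n → Bool) → ℕ → Subset n → Fin n → Bool
  startsWith α k S i = isYes (i ∈? S) ∧ (consistent α k (S - i) ∧ precedesAll α S i)

  -- The child of the ∧-node for (S, i) in which a variable v may occur: the literal
  -- for the other endpoint if v touches i, the node for S − i otherwise.
  owner : {A : Set} → Fin n → (Fin n → A) → A → Var n → A
  owner i lit rest v with Var.i v ≟ i | Var.j v ≟ i
  ... | yes _ | _     = lit (Var.j v)
  ... | no _  | yes _ = lit (Var.i v)
  ... | no _  | no _  = rest

  owner-joins : ∀ {A : Set} {i j v} (lit : Fin n → A) rest → Joins i j v → owner i lit rest v ≡ lit j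
  owner-joins {i = i} {v = v} lit rest joins with Var.i v ≟ i | Var.j v ≟ i | joins
  ... | yes _    | _     | inj₁ (_ , refl)  = refl
  ... | yes vi≡i | _     | inj₂ (_ , vj≡i)  = ⊥-elim (endpoints-distinct v (trans vi≡i (sym vj≡i)))
  ... | no vi≢i  | _     | inj₁ (vi≡i , _)  = ⊥-elim (vi≢i vi≡i)
  ... | no _     | yes _ | inj₂ (refl , _)  = refl
  ... | no _     | no vj≢i | inj₂ (_ , vj≡i) = ⊥-elim (vj≢i vj≡i)

  owner-avoids : ∀ {A : Set} {i v} (lit : Fin n → A) rest → Var.i v ≢ i → Var.j v ≢ i → owner i lit rest v ≡ rest
  owner-avoids {i = i} {v} lit rest vi≢i vj≢i with Var.i v ≟ i | Var.j v ≟ i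
  ... | yes vi≡i | _        = ⊥-elim (vi≢i vi≡i)
  ... | no _     | yes vj≡i = ⊥-elim (vj≢i vj≡i)
  ... | no _     | no _     = refl

  Within-Joins : ∀ {S i j v} → i ∈ₛ S → j ∈ₛ S → Joins i j v → Within S v
  Within-Joins i∈S j∈S (inj₁ (refl , refl)) = i∈S , j∈S
  Within-Joins i∈S j∈S (inj₂ (refl , refl)) = j∈S , i∈S

  K : ℕ
  K = 2 + n

  open Building {Var n} K

  litGate : ∀ {m} → Subset n → Fin n → Fin n → Gate (Var n) m
  litGate S i j = guardedGate (relevant? S i j) (beforeGate i j)

  litNode : ∀ {m₀} {C₀ : Circ (Var n) m₀} S i j →
            Step C₀ 1 (λ α → litValue α S i j) (λ v → Within S v × Joins i j v)
  litNode S i j b _ = pushGate b (litGate S i j) (guardedGate-dec vs d g (beforeGate-dec vs i j))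
    (≤-trans (guardedGate-fanIn d g) (≤-trans (≤-reflexive (beforeGate-fanIn i j)) z≤n))
    (λ α → trans (guardedGate-eval α _ d g) (cong (guarded d) (beforeGate-eval α _ i j)))
    lit-vars
    where
      vs : Vec (List (Var n)) (nodes b)
      vs = vars (circ b)
      d : Dec (i ∈ₛ S × j ∈ₛ S)
      d = relevant? S i j
      g : Gate (Var n) (nodes b)
      g = beforeGate i j
      lit-vars : ∀ {v} → v ∈ varsGate vs (litGate S i j) → Within S v × Joins i j v
      lit-vars {v} v∈ with guardedGate-vars vs d g v∈
      ... | (i∈S , j∈S) , v∈g = let joins = beforeGate-vars vs i j v∈g in Within-Joins {v = v} i∈S j∈S joins , joins

  module AndGate {m} (vs : Vec (List (Var n)) m) (S : Subset n) (i : Fin n) (member rest : Fin m) (lit : Fin n → Fin m)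
                 (member-vars : ∀ {v} → v ∈ lookup vs member → ⊥)
                 (rest-vars : ∀ {v} → v ∈ lookup vs rest → Within (S - i) v)
                 (lit-vars : ∀ {j v} → v ∈ lookup vs (lit j) → Within S v × Joins i j v) where

    children : List (Fin m)
    children = member ∷ rest ∷ map lit (allFin n)

    rest-avoids : ∀ {v} → v ∈ lookup vs rest → Var.i v ≢ i × Var.j v ≢ i
    rest-avoids v∈ = let vi∈ , vj∈ = rest-vars v∈ in
      (λ eq → x∉p-x (subst (_∈ₛ S - i) eq vi∈)) , (λ eq → x∉p-x (subst (_∈ₛ S - i) eq vj∈))

    owns : ∀ {c v} → c ∈ children → v ∈ lookup vs c → c ≡ owner i lit rest v
    owns (here refl)         v∈ = ⊥-elim (member-vars v∈)
    owns (there (here refl)) v∈ = let vi≢i , vj≢i = rest-avoids v∈ in sym (owner-avoids lit rest vi≢i vj≢i)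
    owns (there (there c∈)) v∈ with ∈-map⁻ lit c∈
    ... | j , _ , refl = sym (owner-joins lit rest (proj₂ (lit-vars v∈)))

    decomposable : DecGate vs (andG children)
    decomposable = DecGate-byOwner vs children (owner i lit rest) owns

    within : ∀ {c v} → c ∈ children → v ∈ lookup vs c → Within S v
    within (here refl)         v∈ = ⊥-elim (member-vars v∈)
    within (there (here refl)) v∈ = let vi∈ , vj∈ = rest-vars v∈ in p─q⊆p S _ vi∈ , p─q⊆p S _ vj∈
    within (there (there c∈)) v∈ with ∈-map⁻ lit c∈
    ... | j , _ , refl = proj₁ (lit-vars v∈)

    fanIn-children : length children ≡ K
    fanIn-children = cong (2 +_) (trans (length-map lit (allFin n)) (length-tabulate (λ j → j)))

  andSize : ℕ
  andSize = 2 + n * 1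

  ConsistencyTable : ∀ {m₀} → Circ (Var n) m₀ → ℕ → (Subset n → Fin m₀) → Set
  ConsistencyTable C₀ k table = ∀ S → Computes C₀ (table S) (λ α → consistent α k S) (Within S)

  andNode : ∀ {m₀} {C₀ : Circ (Var n) m₀} k {table} → ConsistencyTable C₀ k table →
            ∀ S i → Step C₀ andSize (λ α → startsWith α k S i) (Within S)
  andNode {C₀ = C₀} k {table} table-ok S i b e = lits ⨾ member ⨾ conjunction
    where
      lits : Growth b (n * 1) (Fin n) (λ j α → litValue α S i j) (λ j v → Within S v × Joins i j v)
      lits = forFin n (litNode S i) b e
      member : Growth (result lits) 1 Unit.⊤ (λ _ α → isYes (i ∈? S)) (λ _ _ → ⊥)
      member = pushGate (result lits) (indicatorGate (i ∈? S))
        (indicatorGate-dec _ (i ∈? S)) (≤-trans (≤-reflexive (indicatorGate-fanIn (i ∈? S))) z≤n)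
        (λ α → indicatorGate-eval α _ (i ∈? S)) (indicatorGate-vars _ (i ∈? S))
      b₂ : Builder
      b₂ = result member
      e₂ : C₀ ⊑ circ b₂
      e₂ = ⊑-trans e (⊑-trans (extends lits) (extends member))
      rest : Fin (nodes b₂)
      rest = weaken e₂ (table (S - i))
      rest-ok : Computes (circ b₂) rest (λ α → consistent α k (S - i)) (Within (S - i))
      rest-ok = Computes-weaken e₂ (table-ok (S - i))
      lit : Fin n → Fin (nodes b₂)
      lit j = weaken (extends member) (node lits j)
      lit-ok : ∀ j → Computes (circ b₂) (lit j) (λ α → litValue α S i j) (λ v → Within S v × Joins i j v)
      lit-ok j = Computes-weaken (extends member) (computes lits j)
      open AndGate (vars (circ b₂)) S i (node member tt) rest lit
                   (support (computes member tt)) (support rest-ok) (λ {j} → support (lit-ok j))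
      conjunction : Growth b₂ 1 Unit.⊤ (λ _ α → startsWith α k S i) (λ _ → Within S)
      conjunction = pushGate b₂ (andG children) decomposable (≤-reflexive fanIn-children)
        (λ α → cong₂ _∧_ (value (computes member tt) α) (cong₂ _∧_ (value rest-ok α)
          (cong and (trans (sym (map-∘ (allFin n))) (map-cong (λ j → value (lit-ok j) α) (allFin n))))))
        (varsGate-children (vars (circ b₂)) children within)

  orSize : ℕ
  orSize = 1 + n * andSize

  orNode : ∀ {m₀} {C₀ : Circ (Var n) m₀} k {table} → ConsistencyTable C₀ k table →
           ∀ S → Step C₀ orSize (λ α → consistent α (suc k) S) (Within S)
  orNode k table-ok S b e = ands ⨾ disjunction
    where
      ands : Growth b (n * andSize) (Fin n) (λ i α → startsWith α k S i) (λ _ → Within S)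
      ands = forFin n (andNode k table-ok S) b e
      vs : Vec (List (Var n)) (nodes (result ands))
      vs = vars (circ (result ands))
      children : List (Fin (nodes (result ands)))
      children = map (node ands) (allFin n)
      disjunction : Growth (result ands) 1 Unit.⊤ (λ _ α → consistent α (suc k) S) (λ _ → Within S)
      disjunction = pushGate (result ands) (orG children) tt
        (≤-trans (≤-reflexive (trans (length-map (node ands) (allFin n)) (length-tabulate (λ i → i)))) (m≤n+m n 2))
        (λ α → cong or (trans (sym (map-∘ (allFin n))) (map-cong (λ i → value (computes ands i) α) (allFin n))))
        (varsGate-children vs children (map-children vs (node ands) (allFin n) (λ i → support (computes ands i))))

  layerSize : ℕ → ℕ
  layerSize zero    = 1
  layerSize (suc k) = 2 ^ n * orSize + layerSize k

  layer : ∀ k → Growth empty (layerSize k) (Subset n) (λ S α → consistent α k S) Within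
  layer zero    = growth (result g) (extends g) (grows g) (λ _ → node g tt) λ _ → record
    { value = value (computes g tt) ; support = λ v∈ → ⊥-elim (support (computes g tt) v∈) }
    where
      g : Growth empty 1 Unit.⊤ (λ _ _ → true) (λ _ _ → ⊥)
      g = pushGate empty top tt z≤n (λ _ → refl) (λ ())
  layer (suc k) = g ⨾ forSubset n (orNode k (computes g)) (result g) ⊑-refl
    where g = layer k

  circuit : RCirc (Var n)
  circuit = rcirc (nodes (result (layer n))) (circ (result (layer n))) (node (layer n) ⊤)

  circuit-dnnf : IsDNNF (RCirc.circ circuit)
  circuit-dnnf = dnnf (result (layer n))

  circuit-eval : ∀ α → eval circuit α ≡ consistent α n ⊤
  circuit-eval = value (computes (layer n) ⊤)

module Semantics (n : ℕ) (α : Var n → Bool) where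

  open LinCircuit n

  before-< : ∀ {i j} (i<j : toℕ i < toℕ j) → before α i j ≡ α (x i j i<j)
  before-< {i} {j} i<j with <-cmp (toℕ i) (toℕ j)
  ... | tri< i<j′ _ _ = cong (λ p → α (x i j p)) (<-irrelevant i<j′ i<j)
  ... | tri≈ ¬i<j _ _ = ⊥-elim (¬i<j i<j)
  ... | tri> ¬i<j _ _ = ⊥-elim (¬i<j i<j)

  before-> : ∀ {i j} (i<j : toℕ i < toℕ j) → before α j i ≡ not (α (x i j i<j))
  before-> {i} {j} i<j with <-cmp (toℕ j) (toℕ i)
  ... | tri< j<i _ _  = ⊥-elim (<-asym i<j j<i)
  ... | tri≈ _ _ ¬i<j = ⊥-elim (¬i<j i<j)
  ... | tri> _ _ i<j′ = cong (λ p → not (α (x i j p))) (<-irrelevant i<j′ i<j)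

  before-refl : ∀ i → T (before α i i)
  before-refl i with <-cmp (toℕ i) (toℕ i)
  ... | tri< i<i _ _ = ⊥-elim (<-irrefl refl i<i)
  ... | tri≈ _ _ _   = tt
  ... | tri> _ _ i<i = ⊥-elim (<-irrefl refl i<i)

  record Ranking (S : Subset n) : Set where
    field
      rank      : Fin n → ℕ
      injective : ∀ {a b} → a ∈ₛ S → b ∈ₛ S → rank a ≡ rank b → a ≡ b
      ordered   : ∀ {a b} → a ∈ₛ S → b ∈ₛ S → rank a < rank b → T (before α a b)

  open Ranking

  Ranking-empty : ∀ {S} → (∀ {a} → ¬ a ∈ₛ S) → Ranking S
  Ranking-empty ∉S = record
    { rank = λ _ → 0 ; injective = λ a∈ _ _ → ⊥-elim (∉S a∈) ; ordered = λ a∈ _ _ → ⊥-elim (∉S a∈) }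

  Ranking-cons : ∀ {S i} → i ∈ₛ S → (∀ {j} → j ∈ₛ S → T (before α i j)) → Ranking (S - i) → Ranking S
  Ranking-cons {S} {i} i∈S first r = record { rank = rank′ ; injective = injective′ ; ordered = ordered′ }
    where
      shift : ∀ {a} → Dec (a ≡ i) → ℕ
      shift {a} (yes _) = 0
      shift {a} (no _)  = suc (rank r a)
      rank′ : Fin n → ℕ
      rank′ a = shift (a ≟ i)
      injective′ : ∀ {a b} → a ∈ₛ S → b ∈ₛ S → rank′ a ≡ rank′ b → a ≡ b
      injective′ {a} {b} a∈ b∈ eq with a ≟ i | b ≟ i
      ... | yes a≡i | yes b≡i = trans a≡i (sym b≡i)
      ... | no a≢i  | no b≢i  = injective r (x∈p∧x≢y⇒x∈p-y a∈ a≢i) (x∈p∧x≢y⇒x∈p-y b∈ b≢i) (suc-injective eq)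
      ordered′ : ∀ {a b} → a ∈ₛ S → b ∈ₛ S → rank′ a < rank′ b → T (before α a b)
      ordered′ {a} {b} a∈ b∈ lt with a ≟ i | b ≟ i
      ... | yes refl | yes _  = ⊥-elim (<-irrefl refl lt)
      ... | yes refl | no _   = first b∈
      ... | no a≢i   | no b≢i = ordered r (x∈p∧x≢y⇒x∈p-y a∈ a≢i) (x∈p∧x≢y⇒x∈p-y b∈ b≢i) (s<s⁻¹ lt)

  startsWith⁻ : ∀ {k S i} → T (startsWith α k S i) →
                i ∈ₛ S × T (consistent α k (S - i)) × (∀ {j} → j ∈ₛ S → T (before α i j))
  startsWith⁻ {k} {S} {i} t =
    let i∈? , rest = Equivalence.to (T-∧ {isYes (i ∈? S)} {consistent α k (S - i) ∧ precedesAll α S i}) t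
        consistent-rest , lits = Equivalence.to (T-∧ {consistent α k (S - i)} {precedesAll α S i}) rest
        i∈S = toWitness {a? = i ∈? S} i∈?
        lit : ∀ j → T (litValue α S i j)
        lit j = All.lookup (all⁺ (litValue α S i) (allFin n) lits) (∈-allFin j)
    in i∈S , consistent-rest , λ {j} j∈S → T-guarded⁻ (relevant? S i j) (lit j) (i∈S , j∈S)

  startsWith⁺ : ∀ {k S i} → i ∈ₛ S → T (consistent α k (S - i)) → (∀ {j} → j ∈ₛ S → T (before α i j)) →
                T (startsWith α k S i)
  startsWith⁺ {k} {S} {i} i∈S consistent-rest first =
    Equivalence.from (T-∧ {isYes (i ∈? S)} {consistent α k (S - i) ∧ precedesAll α S i}) (fromWitness i∈S ,
      Equivalence.from (T-∧ {consistent α k (S - i)} {precedesAll α S i}) (consistent-rest , lits))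
    where
      lits : T (precedesAll α S i)
      lits = all⁻ (litValue α S i) {xs = allFin n}
               (All.tabulate λ {j} _ → T-guarded⁺ (relevant? S i j) λ (_ , j∈S) → first j∈S)

  consistent⇒Ranking : ∀ k S → ∣ S ∣ ≡ k → T (consistent α k S) → Ranking S
  consistent⇒Ranking zero    S ∣S∣≡0 _ = Ranking-empty λ a∈S → 0≢1+n (trans (sym ∣S∣≡0) (∣p∣≡suc∣p-x∣ a∈S))
  consistent⇒Ranking (suc k) S ∣S∣≡ t =
    let i , starts = satisfied (any⁻ (startsWith α k S) (allFin n) t)
        i∈S , consistent-rest , first = startsWith⁻ {k} starts
        ∣S-i∣≡ = suc-injective (trans (sym (∣p∣≡suc∣p-x∣ i∈S)) ∣S∣≡)
    in Ranking-cons i∈S first (consistent⇒Ranking k (S - i) ∣S-i∣≡ consistent-rest)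

  Ranking⇒lin : Ranking ⊤ → lin n α
  Ranking⇒lin r = (λ a b → rank r a < rank r b) , <-on-injective-isStrictTotalOrder (rank r) inj , match
    where
      inj : ∀ {a b} → rank r a ≡ rank r b → a ≡ b
      inj = injective r ∈⊤ ∈⊤
      match : (v : Var n) → (α v ≡ true) ⇔ (rank r (Var.i v) < rank r (Var.j v))
      match (x i j i<j) = mk⇔ to from
        where
          to : α (x i j i<j) ≡ true → rank r i < rank r j
          to αv with <-cmp (rank r i) (rank r j)
          ... | tri< lt _ _ = lt
          ... | tri≈ _ eq _ = ⊥-elim (<-irrefl (cong toℕ (inj eq)) i<j)
          ... | tri> _ _ gt = ⊥-elim (subst (λ b → T (not b)) αv (subst T (before-> i<j) (ordered r ∈⊤ ∈⊤ gt)))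
          from : rank r i < rank r j → α (x i j i<j) ≡ true
          from lt = Equivalence.to T-≡ (subst T (before-< i<j) (ordered r ∈⊤ ∈⊤ lt))

  module _ {_≺_ : Fin n → Fin n → Set} (sto : IsStrictTotalOrder _≡_ _≺_)
           (match : (v : Var n) → (α v ≡ true) ⇔ (Var.i v ≺ Var.j v)) where

    open IsStrictTotalOrder sto using (asym)

    before-≺ : ∀ {a b} → a ≺ b → T (before α a b)
    before-≺ {a} {b} a≺b with <-cmp (toℕ a) (toℕ b)
    ... | tri< a<b _ _ = Equivalence.from T-≡ (Equivalence.from (match (x a b a<b)) a≺b)
    ... | tri≈ _ _ _   = tt
    ... | tri> _ _ b<a with α (x b a b<a) in αv
    ...   | false = tt
    ...   | true  = ⊥-elim (asym a≺b (Equivalence.to (match (x b a b<a)) αv))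

    ordered⇒consistent : ∀ k S → ∣ S ∣ ≡ k → T (consistent α k S)
    ordered⇒consistent zero    S _     = tt
    ordered⇒consistent (suc k) S ∣S∣≡ =
      let m , m∈S , m-least = least sto S (∣p∣≡suc⇒nonempty ∣S∣≡)
          ∣S-m∣≡ = suc-injective (trans (sym (∣p∣≡suc∣p-x∣ m∈S)) ∣S∣≡)
          first : ∀ {j} → j ∈ₛ S → T (before α m j)
          first j∈S = [ before-≺ , (λ { refl → before-refl m }) ]′ (m-least j∈S)
      in any⁺ (startsWith α k S) (lose (∈-allFin m) (startsWith⁺ {k} m∈S (ordered⇒consistent k (S - m) ∣S-m∣≡) first))

  consistent⇔lin : (consistent α n ⊤ ≡ true) ⇔ lin n α
  consistent⇔lin = mk⇔
    (λ t → Ranking⇒lin (consistent⇒Ranking n ⊤ (∣⊤∣≡n n) (Equivalence.from T-≡ t)))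
    (λ { (_ , sto , match) → Equivalence.to T-≡ (ordered⇒consistent sto match n ⊤ (∣⊤∣≡n n)) })

circuit-expresses : ∀ n → Expresses (LinCircuit.circuit n) (lin n)
circuit-expresses n α = mk⇔ (λ evaluates → to (trans (sym (circuit-eval α)) (lower evaluates)))
                            (λ l → lift (trans (circuit-eval α) (from l)))
  where
    open LinCircuit n
    open Equivalence (Semantics.consistent⇔lin n α)

n<2^n : ∀ n → n < 2 ^ n
n<2^n zero    = s≤s z≤n
n<2^n (suc n) = +-mono-≤ (m^n>0 2 n) (≤-trans (n<2^n n) (m≤m+n (2 ^ n) 0))

module PowerBounds (M : ℕ) (2≤M : 2 ≤ M) where

  1≤M^ : ∀ p → 1 ≤ M ^ p
  1≤M^ zero    = ≤-refl
  1≤M^ (suc p) = *-mono-≤ (≤-trans (s≤s z≤n) 2≤M) (1≤M^ p)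

  ≤M^1 : ∀ {a} → a ≤ M → a ≤ M ^ 1
  ≤M^1 {a} a≤M = ≤-trans a≤M (≤-reflexive (sym (*-identityʳ M)))

  +-≤M^ : ∀ {a b} p → a ≤ M ^ p → b ≤ M ^ p → a + b ≤ M ^ suc p
  +-≤M^ {a} {b} p a≤ b≤ = begin
    a + b             ≤⟨ +-mono-≤ a≤ b≤ ⟩
    M ^ p + M ^ p     ≡⟨ cong (M ^ p +_) (sym (+-identityʳ (M ^ p))) ⟩
    2 * M ^ p         ≤⟨ *-monoˡ-≤ (M ^ p) 2≤M ⟩
    M ^ suc p         ∎
    where open ≤-Reasoning

  *-≤M^ : ∀ {a b} p q → a ≤ M ^ p → b ≤ M ^ q → a * b ≤ M ^ (p + q)
  *-≤M^ p q a≤ b≤ = ≤-trans (*-mono-≤ a≤ b≤) (≤-reflexive (sym (^-distribˡ-+-* M p q)))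

module Size (n : ℕ) where

  open LinCircuit n
  open Building {Var n} K

  layerSize≤ : ∀ k → layerSize k ≤ suc k * (2 ^ n * orSize)
  layerSize≤ zero    = ≤-trans (*-mono-≤ (m^n>0 2 n) (s≤s z≤n)) (m≤m+n _ 0)
  layerSize≤ (suc k) = +-monoʳ-≤ (2 ^ n * orSize) (layerSize≤ k)

  size≤layerSize : size circuit ≤ suc K * layerSize n
  size≤layerSize = begin
    nodes b + edges (circ b) ≤⟨ +-monoʳ-≤ (nodes b) (edges≤ b) ⟩
    nodes b + K * nodes b    ≡⟨ cong (λ m → m + K * m) (trans (grows (layer n)) (+-identityʳ _)) ⟩
    suc K * layerSize n      ∎
    where
      b : Builder
      b = result (layer n)
      open ≤-Reasoning

  circuit-size≤ : 1 ≤ n → size circuit ≤ 2 ^ (24 * n)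
  circuit-size≤ 1≤n = begin
    size circuit                                ≤⟨ size≤layerSize ⟩
    (3 + n) * layerSize n                       ≤⟨ *-monoʳ-≤ (3 + n) (layerSize≤ n) ⟩
    (3 + n) * (suc n * (2 ^ n * orSize))        ≤⟨ *-≤M^ 1 5 (≤M^1 3+n≤M) (*-≤M^ 1 4 (≤M^1 (≤-trans (m≤n+m (suc n) 2) 3+n≤M))
                                                     (*-≤M^ 1 3 (≤M^1 (^-monoʳ-≤ 2 (m≤n+m n 3))) orSize≤)) ⟩
    M ^ 6                                       ≡⟨ ^-*-assoc 2 (3 + n) 6 ⟩
    2 ^ ((3 + n) * 6)                           ≤⟨ ^-monoʳ-≤ 2 exponent≤ ⟩
    2 ^ (24 * n)                                ∎
    where
      open ≤-Reasoning
      M : ℕ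
      M = 2 ^ (3 + n)
      3+n≤M : 3 + n ≤ M
      3+n≤M = <⇒≤ (n<2^n (3 + n))
      open PowerBounds M (≤-trans (s≤s (s≤s z≤n)) 3+n≤M)
      orSize≤ : orSize ≤ M ^ 3
      orSize≤ = +-≤M^ 2 (1≤M^ 2) (*-≤M^ 1 1 (≤M^1 (≤-trans (m≤n+m n 3) 3+n≤M))
                  (≤M^1 (≤-trans (≤-reflexive (cong (2 +_) (*-identityʳ n))) (≤-trans (n≤1+n _) 3+n≤M))))
      exponent≤ : (3 + n) * 6 ≤ 24 * n
      exponent≤ = begin
        (3 + n) * 6   ≡⟨ *-distribʳ-+ 6 3 n ⟩
        18 + n * 6    ≤⟨ +-mono-≤ (*-monoʳ-≤ 18 1≤n) (≤-reflexive (*-comm n 6)) ⟩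
        18 * n + 6 * n ≡⟨ sym (*-distribʳ-+ n 18 6) ⟩
        24 * n        ∎

proposition4 : Σ ℕ λ C → 1 ≤ C × ((n : ℕ) → 1 ≤ n →
                 Σ (RCirc (Var n)) λ D →
                   IsDNNF (RCirc.circ D) × size D ≤ 2 ^ (C * n) × Expresses D (lin n))
proposition4 = 24 , s≤s z≤n , λ n 1≤n →
  LinCircuit.circuit n , LinCircuit.circuit-dnnf n , Size.circuit-size≤ n 1≤n , circuit-expresses n
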